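{- Let $m>1$ be an integer and let $\mathcal{F}(\mathbb{B}(2m),m)$ be the sequence defined in the context. (i) Let $\tfrac{h}{k}\in\mathcal{F}(\mathbb{B}(2m),m)$ with $\tfrac hk\le\tfrac12$. (a) If $\tfrac{h}{k}\neq\tfrac{0}{1}$, let $a,b$ be integers with $(k-h)a\equiv -1\pmod{h}$, $\left\lceil\tfrac{hm}{k-h}\right\rceil-h\leq a\leq \left\lceil\tfrac{hm}{k-h}\right\rceil-1$, and $hb\equiv 1\pmod{k-h}$, $m-k+h+1\leq b\leq m$. Then $a\big/\tfrac{ka+1}{h}=\tfrac{hb-1}{k-h}\big/\tfrac{kb-1}{k-h}$, and this fraction immediately precedes $\tfrac hk$ in $\mathcal{F}(\mathbb{B}(2m),m)$. (b) If $\tfrac{h}{k}\neq\tfrac{1}{2}$, let $a,b$ be integers with $(k-h)a\equiv 1\pmod{h}$, $\left\lceil\tfrac{hm+2}{k-h}\right\rceil-h\leq a\leq \left\lceil\tfrac{hm+2}{k-h}\right\rceil-1$, and $hb\equiv -1\pmod{k-h}$, $m-k+h+1\leq b\leq m$. Then $a\big/\tfrac{ka-1}{h}=\tfrac{hb+1}{k-h}\big/\tfrac{kb+1}{k-h}$, and this fraction immediately succeeds $\tfrac hk$ in $\mathcal{F}(\mathbb{B}(2m),m)$. (ii) Let $\tfrac{h}{k}\in\mathcal{F}(\mathbb{B}(2m),m)$ with $\tfrac hk\ge\tfrac12$. (a) If $\tfrac{h}{k}\neq\tfrac{1}{2}$, let $a,b$ be integers with $ka\equiv -1\pmod{h}$,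 $m-h+1\leq a\leq m$, and $hb\equiv 1\pmod{k-h}$, $\left\lceil\tfrac{(k-h)m+2}{h}\right\rceil-k+h\leq b\leq \left\lceil\tfrac{(k-h)m+2}{h}\right\rceil-1$. Then $a\big/\tfrac{ka+1}{h}=\tfrac{hb-1}{k-h}\big/\tfrac{kb-1}{k-h}$, and this fraction immediately precedes $\tfrac hk$ in $\mathcal{F}(\mathbb{B}(2m),m)$. (b) If $\tfrac{h}{k}\neq\tfrac{1}{1}$, let $a,b$ be integers with $ka\equiv 1\pmod{h}$, $m-h+1\leq a\leq m$, and $hb\equiv -1\pmod{k-h}$, $\left\lceil\tfrac{(k-h)m}{h}\right\rceil-k+h\leq b\leq \left\lceil\tfrac{(k-h)m}{h}\right\rceil-1$. Then $a\big/\tfrac{ka-1}{h}=\tfrac{hb+1}{k-h}\big/\tfrac{kb+1}{k-h}$, and this fraction immediately succeeds $\tfrac hk$ in $\mathcal{F}(\mathbb{B}(2m),m)$.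
   Context: For an integer $n\ge1$, the Farey sequence $\mathcal{F}_n$ of order $n$ is the ascending sequence of all rational numbers $\tfrac{h}{k}$ written in lowest terms ($\gcd(h,k)=1$) with $0\le \tfrac hk\le 1$ and $1\le k\le n$. For an integer $m>1$, $\mathcal{F}(\mathbb{B}(2m),m)$ denotes the subsequence of $\mathcal{F}_{2m}$ consisting of those (reduced) fractions $\tfrac hk\in\mathcal{F}_{2m}$ with $k-m\le h\le m$. "Precedes"/"succeeds" mean being the element immediately before/after in this sequence. The notation $x\big/y$ denotes the fraction with numerator $x$ and denominator $y$. -}

module Defs where

open import Data.Nat as ℕ using (ℕ; zero; suc)
open import Data.Nat.DivMod as ℕD using ()
open import Data.Integer using (ℤ; +_; 0ℤ; 1ℤ; _+_; _-_; _*_; _≤_; _<_; ∣_∣)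
open import Data.Integer.GCD using (gcd)
open import Data.Product using (_×_)
open import Relation.Binary.PropositionalEquality using (_≡_)
open import Relation.Nullary using (¬_)

-- Ceiling of n / d on naturals; the value for d = 0 is an arbitrary
-- convention (0) and never used by the statement (denominators are > 0 there).
ceilℕ : ℕ → ℕ → ℕ
ceilℕ n zero = 0
ceilℕ n (suc d) = (n ℕ.+ d) ℕD./ suc d

-- ⌈ x / d ⌉ for integers x ≥ 0, d > 0 (only used on such arguments).
ceilDiv : ℤ → ℤ → ℤ
ceilDiv x d = + ceilℕ ∣ x ∣ ∣ d ∣

-- h/k (numerator h, denominator k) belongs to F(B(2m), m):
-- a reduced fraction of the Farey sequence of order 2m (0 ≤ h ≤ k, 1 ≤ k ≤ 2m,
-- gcd(h,k) = 1) with k - m ≤ h ≤ m.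
InFB : ℤ → ℤ → ℤ → Set
InFB m h k =
  0ℤ ≤ h × h ≤ k × 1ℤ ≤ k × k ≤ + 2 * m × gcd h k ≡ 1ℤ × k - m ≤ h × h ≤ m

-- Order on fractions with positive denominators: x/y < x'/y'.
_/_<F_/_ : ℤ → ℤ → ℤ → ℤ → Set
x / y <F x' / y' = x * y' < x' * y

Precedes : ℤ → ℤ → ℤ → ℤ → ℤ → Set
Precedes m p q h k =
  InFB m p q × InFB m h k × (p / q <F h / k) ×
  (∀ x y → InFB m x y → ¬ ((p / q <F x / y) × (x / y <F h / k)))

Succeeds : ℤ → ℤ → ℤ → ℤ → ℤ → Set
Succeeds m p q h k = Precedes m h k p q

module Submission where

open import Defs
open import Data.Nat as ℕ using (ℕ; suc)
import Data.Nat.Properties as ℕP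
import Data.Nat.DivMod as ℕD
import Data.Nat.Coprimality as ℕC
import Data.Nat.Divisibility as ℕDiv
open import Data.Integer
  using (ℤ; +_; +[1+_]; -[1+_]; -_; 0ℤ; 1ℤ; -1ℤ; _+_; _-_; _*_; _≤_; _<_; +≤+; +<+; -<-)
open import Data.Integer.Base using (NonNegative; positive; nonNegative)
import Data.Integer.Properties as ℤP
open import Data.Integer.GCD using (gcd)
open import Data.Integer.Coprimality as ℤC using (Coprime)
open import Data.Integer.Divisibility using (_∣_)
import Data.Integer.Divisibility.Signed as Signed
open import Data.Integer.Tactic.RingSolver using (solve)
open import Data.List using (_∷_; [])
open import Data.Product using (_×_; _,_; Σ; proj₁; proj₂)
open import Relation.Binary.PropositionalEquality
open import Relation.Nullary using (¬_)

-- Write d = k - h and q = a + b. The congruence on a makes (k-h)a ± 1 a multiple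
-- t h of h, and the window for a is chosen so that t lies in (m - d, m], a window of length d
-- containing exactly one solution of h t ≡ ±1 (mod d); hence t = b. Then h q - k a = ±1, so
-- a/q and h/k are Farey neighbours, and any fraction x/y strictly between them has
-- y - x ≥ b + d > m; so nothing of F(B(2m), m) lies between them.
-- The case h/k ≥ 1/2 is the mirror image of the case h/k ≤ 1/2 under x/y ↦ (y - x)/y,
-- which preserves F(B(2m), m) and reverses the order.

i+[j-i]≡j : ∀ i j → i + (j - i) ≡ j
i+[j-i]≡j i j = solve (i ∷ j ∷ [])

i-j+j≡i : ∀ i j → i - j + j ≡ i
i-j+j≡i i j = solve (i ∷ j ∷ [])

i-j+k≡i-[j-k] : ∀ i j k → i - j + k ≡ i - (j - k)
i-j+k≡i-[j-k] i j k = solve (i ∷ j ∷ k ∷ [])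

i≡j+k⇒j≡i-k : ∀ {i j k} → i ≡ j + k → j ≡ i - k
i≡j+k⇒j≡i-k {_} {j} {k} refl = solve (j ∷ k ∷ [])

0≤-via-difference : ∀ {a b d} → a ≤ b → b - a ≡ d → 0ℤ ≤ d
0≤-via-difference a≤b eq = subst (0ℤ ≤_) eq (ℤP.i≤j⇒0≤j-i a≤b)

≤-via-difference : ∀ {a b c d} → a ≤ b → b - a ≡ d - c → c ≤ d
≤-via-difference a≤b eq = ℤP.0≤i-j⇒j≤i (0≤-via-difference a≤b eq)

<-via-difference : ∀ {a b c d} → a < b → b - a ≡ d - c → c < d
<-via-difference {a} {b} {c} {d} a<b eq = ℤP.suc[i]≤j⇒i<j (≤-via-difference (ℤP.i<j⇒suc[i]≤j a<b) (begin
  b - (1ℤ + a)   ≡⟨ solve (a ∷ b ∷ []) ⟩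
  b - a - 1ℤ     ≡⟨ cong (_- 1ℤ) eq ⟩
  d - c - 1ℤ     ≡⟨ solve (c ∷ d ∷ []) ⟩
  d - (1ℤ + c)   ∎))
  where open ≡-Reasoning

i+1≤j⇒i<j : ∀ {i j} → i + 1ℤ ≤ j → i < j
i+1≤j⇒i<j {i} {j} i+1≤j = ℤP.suc[i]≤j⇒i<j (subst (_≤ j) (ℤP.+-comm i 1ℤ) i+1≤j)

i<j⇒1≤j-i : ∀ {i j} → i < j → 1ℤ ≤ j - i
i<j⇒1≤j-i {i} {j} i<j = begin
  1ℤ           ≡⟨ solve (i ∷ []) ⟩
  1ℤ + i - i   ≤⟨ ℤP.+-monoˡ-≤ (- i) (ℤP.i<j⇒suc[i]≤j i<j) ⟩
  j - i        ∎
  where open ℤP.≤-Reasoning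

0≤i*j : ∀ {i j} → 0ℤ ≤ i → 0ℤ ≤ j → 0ℤ ≤ i * j
0≤i*j {i} {j} 0≤i 0≤j = subst (_≤ i * j) (ℤP.*-zeroʳ i) (ℤP.*-monoˡ-≤-nonNeg i ⦃ nonNegative 0≤i ⦄ 0≤j)

0<i*j : ∀ {i j} → 0ℤ < i → 0ℤ < j → 0ℤ < i * j
0<i*j {+[1+ _ ]} {+[1+ _ ]} _ _ = +<+ (ℕ.s≤s ℕ.z≤n)
0<i*j {+ 0} (+<+ ()) _
0<i*j {+[1+ _ ]} {+ 0} _ (+<+ ())

0<i∧0≤i*j⇒0≤j : ∀ {i j} → 0ℤ < i → 0ℤ ≤ i * j → 0ℤ ≤ j
0<i∧0≤i*j⇒0≤j {i} {j} 0<i 0≤ij =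
  ℤP.*-cancelˡ-≤-pos 0ℤ j i ⦃ positive 0<i ⦄ (subst (_≤ i * j) (sym (ℤP.*-zeroʳ i)) 0≤ij)

ceilℕ-bounds : ∀ n d → n ℕ.≤ suc d ℕ.* ceilℕ n (suc d) × suc d ℕ.* ceilℕ n (suc d) ℕ.< n ℕ.+ suc d
ceilℕ-bounds n d = lower , upper
  where
  open ℕP.≤-Reasoning
  q r : ℕ
  q = ceilℕ n (suc d)
  r = (n ℕ.+ d) ℕD.% suc d
  lower : n ℕ.≤ suc d ℕ.* q
  lower = ℕP.+-cancelʳ-≤ d n (suc d ℕ.* q) (begin
    n ℕ.+ d                ≡⟨ ℕD.m≡m%n+[m/n]*n (n ℕ.+ d) (suc d) ⟩
    r ℕ.+ q ℕ.* suc d      ≤⟨ ℕP.+-mono-≤ (ℕP.≤-pred (ℕD.m%n<n (n ℕ.+ d) (suc d)))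
                                          (ℕP.≤-reflexive (ℕP.*-comm q (suc d))) ⟩
    d ℕ.+ suc d ℕ.* q      ≡⟨ ℕP.+-comm d _ ⟩
    suc d ℕ.* q ℕ.+ d      ∎)
  upper : suc d ℕ.* q ℕ.< n ℕ.+ suc d
  upper = begin-strict
    suc d ℕ.* q            ≡⟨ ℕP.*-comm (suc d) q ⟩
    q ℕ.* suc d            ≤⟨ ℕD.m/n*n≤m (n ℕ.+ d) (suc d) ⟩
    n ℕ.+ d                <⟨ ℕP.+-monoʳ-< n (ℕP.n<1+n d) ⟩
    n ℕ.+ suc d            ∎

ceilDiv-bounds : ∀ {x d} → 0ℤ ≤ x → 0ℤ < d → x ≤ d * ceilDiv x d × d * ceilDiv x d < x + d
ceilDiv-bounds {+ n} {+[1+ d ]} _ _ with ceilℕ-bounds n d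
... | lower , upper =
  subst (+ n ≤_) (ℤP.pos-* (suc d) q) (+≤+ lower) ,
  subst₂ _<_ (ℤP.pos-* (suc d) q) (ℤP.pos-+ n (suc d)) (+<+ upper)
  where q = ceilℕ n (suc d)
ceilDiv-bounds {+ n} {+ 0} _ (+<+ ())

gcd≡1⇒coprime : ∀ {x y} → gcd x y ≡ 1ℤ → Coprime x y
gcd≡1⇒coprime g = ℕC.gcd≡1⇒coprime (ℤP.+-injective g)

coprime⇒gcd≡1 : ∀ {x y} → Coprime x y → gcd x y ≡ 1ℤ
coprime⇒gcd≡1 c = cong +_ (ℕC.coprime⇒gcd≡1 c)

coprime-by : ∀ {x y} → (∀ {i} → i Signed.∣ x → i Signed.∣ y → i Signed.∣ 1ℤ) → Coprime x y
coprime-by common {n} (n∣x , n∣y) =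
  ℕDiv.∣1⇒≡1 (Signed.∣⇒∣ᵤ (common {+ n} (Signed.∣ᵤ⇒∣ n∣x) (Signed.∣ᵤ⇒∣ n∣y)))

coprime⇒∣1 : ∀ {x y i} → Coprime x y → i Signed.∣ x → i Signed.∣ y → i Signed.∣ 1ℤ
coprime⇒∣1 c i∣x i∣y =
  Signed.∣ᵤ⇒∣ (subst (ℕDiv._∣ 1) (sym (c (Signed.∣⇒∣ᵤ i∣x , Signed.∣⇒∣ᵤ i∣y))) ℕDiv.∣-refl)

coprime-complement : ∀ {x x' y} → x + x' ≡ y → Coprime x y → Coprime x' y
coprime-complement {x} {x'} refl c = coprime-by {x'} {x + x'} λ i∣x' i∣x+x' →
  coprime⇒∣1 {x} {x + x'} c
    (Signed.∣-trans (Signed.∣m∣n⇒∣m-n i∣x+x' i∣x') (Signed.∣-reflexive (solve (x ∷ x' ∷ []))))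
    i∣x+x'

coprime-summands : ∀ {x x' y} → x + x' ≡ y → Coprime x y → Coprime x' x
coprime-summands {x} {x'} refl c =
  coprime-by {x'} {x} λ i∣x' i∣x → coprime⇒∣1 {x} {x + x'} c i∣x (Signed.∣m∣n⇒∣m+n i∣x i∣x')

bezout⇒coprime : ∀ {u v x y} → u * x ≡ v * y + 1ℤ → Coprime x y
bezout⇒coprime {u} {v} {x} {y} eq = coprime-by {x} {y} λ i∣x i∣y →
  Signed.∣-trans (Signed.∣m∣n⇒∣m-n (Signed.∣n⇒∣m*n u i∣x) (Signed.∣n⇒∣m*n v i∣y))
    (Signed.∣-reflexive (trans (cong (_- v * y) eq) (solve (v ∷ y ∷ []))))

0≤h∧h∣h*a-1⇒h≡1 : ∀ {h a} → 0ℤ ≤ h → h ∣ h * a - 1ℤ → h ≡ 1ℤ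
0≤h∧h∣h*a-1⇒h≡1 {h} {a} 0≤h h∣ha-1 = trans (sym (ℤP.0≤i⇒+∣i∣≡i 0≤h)) (cong +_ (ℕDiv.∣1⇒≡1 h∣1))
  where
  h∣1 : h ∣ 1ℤ
  h∣1 = Signed.∣⇒∣ᵤ {h} {1ℤ} (Signed.∣-trans
    (Signed.∣m∣n⇒∣m-n (Signed.∣m⇒∣m*n a (Signed.∣-refl {h})) (Signed.∣ᵤ⇒∣ {h} {h * a - 1ℤ} h∣ha-1))
    (Signed.∣-reflexive (solve (h ∷ a ∷ []))))

h∣k*a+ε⇒h∣[k-h]*a+ε : ∀ {h k a ε} → h ∣ k * a + ε → h ∣ (k - h) * a + ε
h∣k*a+ε⇒h∣[k-h]*a+ε {h} {k} {a} {ε} h∣ka+ε = Signed.∣⇒∣ᵤ {h} {(k - h) * a + ε} (Signed.∣-trans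
  (Signed.∣m∣n⇒∣m-n (Signed.∣ᵤ⇒∣ {h} {k * a + ε} h∣ka+ε) (Signed.∣m⇒∣m*n a (Signed.∣-refl {h})))
  (Signed.∣-reflexive (solve (h ∷ k ∷ a ∷ ε ∷ []))))

<F-complement : ∀ {x x' y z z' w} → x / y <F z / w → x + x' ≡ y → z + z' ≡ w → z' / w <F x' / y
<F-complement {x} {x'} {_} {z} {z'} x/y<z/w refl refl = begin-strict
  z' * (x + x')                      ≡⟨ solve (x ∷ x' ∷ z ∷ z' ∷ []) ⟩
  x * (z + z') + (x' * z' - x * z)   <⟨ ℤP.+-monoˡ-< (x' * z' - x * z) x/y<z/w ⟩
  z * (x + x') + (x' * z' - x * z)   ≡⟨ solve (x ∷ x' ∷ z ∷ z' ∷ []) ⟩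
  x' * (z + z')                      ∎
  where open ℤP.≤-Reasoning

unimodular⇒<F : ∀ {p q h k} → h * q ≡ p * k + 1ℤ → p / q <F h / k
unimodular⇒<F {p} {q} {h} {k} det =
  ℤP.suc[i]≤j⇒i<j (ℤP.≤-reflexive (trans (ℤP.+-comm 1ℤ (p * k)) (sym det)))

-- x = x (h q - p k) = h (x q - p y) + p (h y - x k), and both brackets are positive.
unimodular-between⇒p+h≤x : ∀ {p q h k x y} → 0ℤ ≤ p → 0ℤ ≤ h → h * q ≡ p * k + 1ℤ →
  p / q <F x / y → x / y <F h / k → p + h ≤ x
unimodular-between⇒p+h≤x {p} {q} {h} {k} {x} {y} 0≤p 0≤h det p/q<x/y x/y<h/k = begin
  p + h                                     ≡⟨ solve (p ∷ h ∷ []) ⟩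
  h * 1ℤ + p * 1ℤ                           ≤⟨ ℤP.+-mono-≤
                                                  (ℤP.*-monoˡ-≤-nonNeg h ⦃ nonNegative 0≤h ⦄ (i<j⇒1≤j-i p/q<x/y))
                                                  (ℤP.*-monoˡ-≤-nonNeg p ⦃ nonNegative 0≤p ⦄ (i<j⇒1≤j-i x/y<h/k)) ⟩
  h * (x * q - p * y) + p * (h * y - x * k) ≡⟨ solve (p ∷ q ∷ h ∷ k ∷ x ∷ y ∷ []) ⟩
  x * (h * q) - x * (p * k)                 ≡⟨ cong (λ v → x * v - x * (p * k)) det ⟩
  x * (p * k + 1ℤ) - x * (p * k)            ≡⟨ solve (p ∷ k ∷ x ∷ []) ⟩
  x                                         ∎
  where open ℤP.≤-Reasoning

InFB-complement : ∀ {M h h' k} → h + h' ≡ k → InFB M h k → InFB M h' k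
InFB-complement {M} {h} {h'} refl (0≤h , h≤k , 1≤k , k≤2M , gcd≡1 , k-M≤h , h≤M) =
  0≤-via-difference h≤k (solve (h ∷ h' ∷ [])) ,
  ℤP.i≤j⇒i≤k+j h ⦃ nonNegative 0≤h ⦄ ℤP.≤-refl ,
  1≤k , k≤2M ,
  coprime⇒gcd≡1 {h'} {h + h'} (coprime-complement {h} refl (gcd≡1⇒coprime {h} {h + h'} gcd≡1)) ,
  ≤-via-difference h≤M (solve (M ∷ h ∷ h' ∷ [])) ,
  ≤-via-difference k-M≤h (solve (M ∷ h ∷ h' ∷ []))

InFB-+ : ∀ {M a b} → 0ℤ ≤ a → 0ℤ < b → a ≤ M → b ≤ M → Coprime a (a + b) → InFB M a (a + b)
InFB-+ {M} {a} {b} 0≤a 0<b a≤M b≤M coprime =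
  0≤a ,
  ℤP.i≤i+j a b ⦃ nonNegative (ℤP.<⇒≤ 0<b) ⦄ ,
  ℤP.i≤j⇒i≤k+j a ⦃ nonNegative 0≤a ⦄ (ℤP.i<j⇒suc[i]≤j 0<b) ,
  ℤP.≤-trans (ℤP.+-mono-≤ a≤M b≤M) (ℤP.≤-reflexive (solve (M ∷ []))) ,
  coprime⇒gcd≡1 {a} {a + b} coprime ,
  ≤-via-difference b≤M (solve (M ∷ a ∷ b ∷ [])) ,
  a≤M

Precedes-complement : ∀ {M p p' q h h' k} → p + p' ≡ q → h + h' ≡ k →
  Precedes M p q h k → Precedes M h' k p' q
Precedes-complement {M} {p} {p'} {_} {h} {h'} refl refl (fp , fh , p/q<h/k , nothing-between) =
  InFB-complement refl fh , InFB-complement refl fp ,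
  <F-complement {p} {p'} {p + p'} {h} {h'} p/q<h/k refl refl ,
  λ x y fxy (h'/k<x/y , x/y<p'/q) → nothing-between (y - x) y (InFB-complement (i+[j-i]≡j x y) fxy)
    (<F-complement {x} {y - x} {y} {p'} {p} x/y<p'/q (i+[j-i]≡j x y) (ℤP.+-comm p' p) ,
     <F-complement {h'} {h} {h + h'} {x} {y - x} h'/k<x/y (ℤP.+-comm h' h) (i+[j-i]≡j x y))

unimodular⇒Precedes : ∀ {M p p' q h h' k} → p + p' ≡ q → h + h' ≡ k → InFB M p q → InFB M h k →
  h * q ≡ p * k + 1ℤ → M < h' + p' → Precedes M p q h k
unimodular⇒Precedes {M} {p} {p'} {_} {h} {h'} refl refl
  fp@(0≤p , p≤q , _) fh@(0≤h , h≤k , _) det M<h'+p' =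
  fp , fh , unimodular⇒<F {p} {p + p'} {h} {h + h'} det ,
  λ x y fxy between → ℤP.<-irrefl refl (no-room x y fxy between)
  where
  open ℤP.≤-Reasoning
  0≤h' : 0ℤ ≤ h'
  0≤h' = 0≤-via-difference h≤k (solve (h ∷ h' ∷ []))
  0≤p' : 0ℤ ≤ p'
  0≤p' = 0≤-via-difference p≤q (solve (p ∷ p' ∷ []))
  det' : p' * (h + h') ≡ h' * (p + p') + 1ℤ
  det' = begin-equality
    p' * (h + h')                                      ≡⟨ solve (p ∷ p' ∷ h ∷ h' ∷ []) ⟩
    h' * (p + p') + (h * (p + p') - p * (h + h'))      ≡⟨ cong (λ v → h' * (p + p') + (v - p * (h + h'))) det ⟩
    h' * (p + p') + (p * (h + h') + 1ℤ - p * (h + h')) ≡⟨ solve (p ∷ p' ∷ h ∷ h' ∷ []) ⟩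
    h' * (p + p') + 1ℤ                                 ∎
  no-room : ∀ x y → InFB M x y → (p / (p + p') <F x / y) × (x / y <F h / (h + h')) → M < M
  no-room x y (_ , _ , _ , _ , _ , y-M≤x , _) (p/q<x/y , x/y<h/k) = begin-strict
    M        <⟨ M<h'+p' ⟩
    h' + p'  ≤⟨ unimodular-between⇒p+h≤x {q = h + h'} {k = p + p'} 0≤h' 0≤p' det'
                  (<F-complement {x} {y - x} {y} {h} {h'} x/y<h/k (i+[j-i]≡j x y) refl)
                  (<F-complement {p} {p'} {p + p'} {x} {y - x} p/q<x/y refl (i+[j-i]≡j x y)) ⟩
    y - x    ≤⟨ ≤-via-difference y-M≤x (solve (M ∷ x ∷ y ∷ [])) ⟩
    M        ∎

-- The window argument

small-multiple≡0 : ∀ {d e} → 0ℤ < d → - d < e * d → e * d < d → e ≡ 0ℤ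
small-multiple≡0 {d} {e} 0<d -d<ed ed<d = between-units
  (ℤP.*-cancelʳ-<-nonNeg d ⦃ 0≤d ⦄ (subst (_< e * d) (sym (ℤP.-1*i≡-i d)) -d<ed))
  (ℤP.*-cancelʳ-<-nonNeg d ⦃ 0≤d ⦄ (subst (e * d <_) (sym (ℤP.*-identityˡ d)) ed<d))
  where
  0≤d : NonNegative d
  0≤d = nonNegative (ℤP.<⇒≤ 0<d)
  between-units : ∀ {e} → -1ℤ < e → e < 1ℤ → e ≡ 0ℤ
  between-units {+ 0} _ _ = refl
  between-units {+[1+ _ ]} _ (+<+ (ℕ.s≤s ()))
  between-units { -[1+ _ ]} (-<- ()) _

congruent-in-window⇒≡ : ∀ {M d x y} → d ∣ x - y → M - d < x → x ≤ M → M - d < y → y ≤ M → x ≡ y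
congruent-in-window⇒≡ {M} {d} {x} {y} d∣x-y M-d<x x≤M M-d<y y≤M
  with Signed.∣ᵤ⇒∣ {d} {x - y} d∣x-y
... | Signed.divides e x-y≡ed = ℤP.i-j≡0⇒i≡j x y (trans x-y≡ed (cong (_* d) e≡0))
  where
  open ℤP.≤-Reasoning
  0<d : 0ℤ < d
  0<d = <-via-difference (ℤP.<-≤-trans M-d<x x≤M) (solve (M ∷ d ∷ []))
  e≡0 : e ≡ 0ℤ
  e≡0 = small-multiple≡0 0<d
    (begin-strict
      - d            ≡⟨ solve (M ∷ d ∷ []) ⟩
      M - d - M      <⟨ ℤP.+-monoˡ-< (- M) M-d<x ⟩
      x - M          ≤⟨ ℤP.+-monoʳ-≤ x (ℤP.neg-mono-≤ y≤M) ⟩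
      x - y          ≡⟨ x-y≡ed ⟩
      e * d          ∎)
    (begin-strict
      e * d          ≡⟨ x-y≡ed ⟨
      x - y          ≤⟨ ℤP.+-monoˡ-≤ (- y) x≤M ⟩
      M - y          <⟨ <-via-difference M-d<y (solve (M ∷ d ∷ y ∷ [])) ⟩
      d              ∎)

multiple-in-window≡ : ∀ {M d h b n} → Coprime d h → 0ℤ < h → h ∣ n → d ∣ h * b - n →
  h * (M - d) < n → n ≤ h * M → M - d < b → b ≤ M → n ≡ h * b
multiple-in-window≡ {M} {d} {h} {b} {n} coprime 0<h h∣n d∣hb-n hM-hd<n n≤hM M-d<b b≤M
  with Signed.∣ᵤ⇒∣ {h} {n} h∣n
... | Signed.divides t n≡th = begin
  n       ≡⟨ n≡th ⟩
  t * h   ≡⟨ cong (_* h) b≡t ⟨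
  b * h   ≡⟨ ℤP.*-comm b h ⟩
  h * b   ∎
  where
  open ≡-Reasoning
  d∣b-t : d ∣ b - t
  d∣b-t = ℤC.coprime-divisor d h (b - t) coprime (subst (d ∣_) hb-n≡h[b-t] d∣hb-n)
    where
    hb-n≡h[b-t] : h * b - n ≡ h * (b - t)
    hb-n≡h[b-t] = trans (cong (λ v → h * b - v) n≡th) (solve (h ∷ b ∷ t ∷ []))
  M-d<t : M - d < t
  M-d<t = ℤP.*-cancelʳ-<-nonNeg h ⦃ nonNegative (ℤP.<⇒≤ 0<h) ⦄
    (subst₂ _<_ (ℤP.*-comm h (M - d)) n≡th hM-hd<n)
  t≤M : t ≤ M
  t≤M = ℤP.*-cancelʳ-≤-pos t M h ⦃ positive 0<h ⦄ (subst₂ _≤_ n≡th (ℤP.*-comm h M) n≤hM)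
  b≡t : b ≡ t
  b≡t = congruent-in-window⇒≡ d∣b-t M-d<b b≤M M-d<t t≤M

nonempty-window⇒0<h : ∀ {c h a} → c - h ≤ a → a ≤ c - 1ℤ → 0ℤ < h
nonempty-window⇒0<h {c} {h} c-h≤a a≤c-1 =
  ℤP.suc[i]≤j⇒i<j (≤-via-difference (ℤP.≤-trans c-h≤a a≤c-1) (solve (c ∷ h ∷ [])))

mediant-window : ∀ {M h d a c x ε} → 0ℤ ≤ d → x ≤ d * c → d * c < x + d → x + ε ≡ h * M + 1ℤ →
  c - h ≤ a → a ≤ c - 1ℤ → h * (M - d) < d * a + ε × d * a + ε ≤ h * M
mediant-window {M} {h} {d} {a} {c} {x} {ε} 0≤d x≤dc dc<x+d x+ε≡hM+1 c-h≤a a≤c-1 =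
  ℤP.suc[i]≤j⇒i<j (begin
    1ℤ + h * (M - d)            ≡⟨ solve (h ∷ M ∷ d ∷ []) ⟩
    h * M + 1ℤ - d * h          ≡⟨ cong (_- d * h) x+ε≡hM+1 ⟨
    x + ε - d * h               ≡⟨ solve (x ∷ ε ∷ d ∷ h ∷ []) ⟩
    x + (ε - d * h)             ≤⟨ ℤP.+-monoˡ-≤ (ε - d * h) x≤dc ⟩
    d * c + (ε - d * h)         ≡⟨ solve (d ∷ c ∷ ε ∷ h ∷ []) ⟩
    d * (c - h) + ε             ≤⟨ ℤP.+-monoˡ-≤ ε (ℤP.*-monoˡ-≤-nonNeg d ⦃ nonNegative 0≤d ⦄ c-h≤a) ⟩
    d * a + ε                   ∎) ,
  (begin
    d * a + ε                   ≤⟨ ℤP.+-monoˡ-≤ ε (ℤP.*-monoˡ-≤-nonNeg d ⦃ nonNegative 0≤d ⦄ a≤c-1) ⟩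
    d * (c - 1ℤ) + ε            ≡⟨ solve (d ∷ c ∷ ε ∷ []) ⟩
    1ℤ + d * c + (ε - d - 1ℤ)   ≤⟨ ℤP.+-monoˡ-≤ (ε - d - 1ℤ) (ℤP.i<j⇒suc[i]≤j dc<x+d) ⟩
    x + d + (ε - d - 1ℤ)        ≡⟨ solve (x ∷ d ∷ ε ∷ []) ⟩
    x + ε - 1ℤ                  ≡⟨ cong (_- 1ℤ) x+ε≡hM+1 ⟩
    h * M + 1ℤ - 1ℤ             ≡⟨ solve (h ∷ M ∷ []) ⟩
    h * M                       ∎)
  where open ℤP.≤-Reasoning

mediant-numerator≡ : ∀ {M h d a b x ε} → Coprime d h → 0ℤ < h → 0ℤ < d → 0ℤ ≤ x →
  x + ε ≡ h * M + 1ℤ → ceilDiv x d - h ≤ a → a ≤ ceilDiv x d - 1ℤ →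
  h ∣ d * a + ε → d ∣ h * b - ε → M - d < b → b ≤ M → d * a + ε ≡ h * b
mediant-numerator≡ {M} {h} {d} {a} {b} {x} {ε}
  coprime 0<h 0<d 0≤x x+ε≡hM+1 c-h≤a a≤c-1 h∣da+ε d∣hb-ε M-d<b b≤M =
  multiple-in-window≡ coprime 0<h h∣da+ε d∣hb-[da+ε] (proj₁ window) (proj₂ window) M-d<b b≤M
  where
  ceiling : x ≤ d * ceilDiv x d × d * ceilDiv x d < x + d
  ceiling = ceilDiv-bounds 0≤x 0<d
  window : h * (M - d) < d * a + ε × d * a + ε ≤ h * M
  window = mediant-window {M} {h} {d} {a} {ceilDiv x d} {x} {ε} (ℤP.<⇒≤ 0<d) (proj₁ ceiling) (proj₂ ceiling)
    x+ε≡hM+1 c-h≤a a≤c-1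
  d∣hb-[da+ε] : d ∣ h * b - (d * a + ε)
  d∣hb-[da+ε] = Signed.∣⇒∣ᵤ {d} {h * b - (d * a + ε)} (Signed.∣-trans
    (Signed.∣m∣n⇒∣m-n (Signed.∣ᵤ⇒∣ {d} {h * b - ε} d∣hb-ε) (Signed.∣m⇒∣m*n a (Signed.∣-refl {d})))
    (Signed.∣-reflexive (solve (h ∷ b ∷ ε ∷ d ∷ a ∷ []))))

mediant-identities : ∀ {h d a b ε} → d * a + ε ≡ h * b →
  h * (a + b) ≡ (h + d) * a + ε × d * a ≡ h * b - ε × d * (a + b) ≡ (h + d) * b - ε
mediant-identities {h} {d} {a} {b} {ε} da+ε≡hb =
  (begin
    h * (a + b)              ≡⟨ solve (h ∷ a ∷ b ∷ []) ⟩
    h * a + h * b            ≡⟨ cong (λ v → h * a + v) da+ε≡hb ⟨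
    h * a + (d * a + ε)      ≡⟨ solve (h ∷ d ∷ a ∷ ε ∷ []) ⟩
    (h + d) * a + ε          ∎) ,
  i≡j+k⇒j≡i-k (sym da+ε≡hb) ,
  (begin
    d * (a + b)              ≡⟨ solve (d ∷ a ∷ b ∷ ε ∷ []) ⟩
    d * a + ε + d * b - ε    ≡⟨ cong (λ v → v + d * b - ε) da+ε≡hb ⟩
    h * b + d * b - ε        ≡⟨ solve (h ∷ d ∷ b ∷ ε ∷ []) ⟩
    (h + d) * b - ε          ∎)
  where open ≡-Reasoning

-- Below one half

predecessor≤½ : ∀ {M h d k a b} → h + d ≡ k → InFB M h k → h ≤ d →
  h ∣ d * a + 1ℤ → ceilDiv (h * M) d - h ≤ a → a ≤ ceilDiv (h * M) d - 1ℤ →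
  d ∣ h * b - 1ℤ → M - d < b → b ≤ M →
  h * (a + b) ≡ k * a + 1ℤ × d * a ≡ h * b - 1ℤ × d * (a + b) ≡ k * b - 1ℤ ×
  Precedes M a (a + b) h k
predecessor≤½ {M} {h} {d} {_} {a} {b} refl fh@(0≤h , _ , _ , _ , gcd≡1 , k-M≤h , h≤M)
  h≤d h∣da+1 c-h≤a a≤c-1 d∣hb-1 M-d<b b≤M =
  h[a+b]≡ka+1 , da≡hb-1 , proj₂ (proj₂ identities) ,
  unimodular⇒Precedes {M} {a} {b} {a + b} {h} {d} refl refl (InFB-+ 0≤a 0<b a≤M b≤M coprime) fh
    (trans h[a+b]≡ka+1 (cong (_+ 1ℤ) (ℤP.*-comm (h + d) a)))
    (<-via-difference M-d<b (solve (M ∷ d ∷ b ∷ [])))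
  where
  open ℤP.≤-Reasoning
  0<h : 0ℤ < h
  0<h = nonempty-window⇒0<h {ceilDiv (h * M) d} c-h≤a a≤c-1
  0<d : 0ℤ < d
  0<d = ℤP.<-≤-trans 0<h h≤d
  0≤M-d : 0ℤ ≤ M - d
  0≤M-d = 0≤-via-difference k-M≤h (solve (M ∷ h ∷ d ∷ []))
  0<b : 0ℤ < b
  0<b = ℤP.≤-<-trans 0≤M-d M-d<b
  identities : h * (a + b) ≡ (h + d) * a + 1ℤ × d * a ≡ h * b - 1ℤ × d * (a + b) ≡ (h + d) * b - 1ℤ
  identities = mediant-identities {h} {d} {a} {b} {1ℤ}
    (mediant-numerator≡ {x = h * M} (coprime-summands {h} refl (gcd≡1⇒coprime {h} {h + d} gcd≡1))
      0<h 0<d (0≤i*j 0≤h (ℤP.≤-trans 0≤h h≤M)) refl c-h≤a a≤c-1 h∣da+1 d∣hb-1 M-d<b b≤M)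
  h[a+b]≡ka+1 : h * (a + b) ≡ (h + d) * a + 1ℤ
  h[a+b]≡ka+1 = proj₁ identities
  da≡hb-1 : d * a ≡ h * b - 1ℤ
  da≡hb-1 = proj₁ (proj₂ identities)
  0≤a : 0ℤ ≤ a
  0≤a = 0<i∧0≤i*j⇒0≤j 0<d (subst (0ℤ ≤_) (sym da≡hb-1) (ℤP.i≤j⇒0≤j-i (ℤP.i<j⇒suc[i]≤j (0<i*j 0<h 0<b))))
  a≤M : a ≤ M
  a≤M = ℤP.*-cancelˡ-≤-pos a M d ⦃ positive 0<d ⦄ (begin
    d * a        ≡⟨ da≡hb-1 ⟩
    h * b - 1ℤ   ≤⟨ ℤP.i-j≤i (h * b) 1ℤ ⟩
    h * b        ≤⟨ ℤP.*-monoˡ-≤-nonNeg h ⦃ nonNegative 0≤h ⦄ b≤M ⟩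
    h * M        ≤⟨ ℤP.*-monoʳ-≤-nonNeg M ⦃ nonNegative (ℤP.≤-trans 0≤h h≤M) ⦄ h≤d ⟩
    d * M        ∎)
  coprime : Coprime a (a + b)
  coprime = ℤC.sym {a + b} {a} (bezout⇒coprime {h} {h + d} h[a+b]≡ka+1)

-- Here h = d is possible only for 1/2: then h ∣ h a - 1 forces h = 1.
successor≤½ : ∀ {M h d k a b} → h + d ≡ k → InFB M h k → h ≤ d → ¬ (h ≡ 1ℤ × k ≡ + 2) →
  h ∣ d * a - 1ℤ → ceilDiv (h * M + + 2) d - h ≤ a → a ≤ ceilDiv (h * M + + 2) d - 1ℤ →
  d ∣ h * b + 1ℤ → M - d < b → b ≤ M →
  h * (a + b) ≡ k * a - 1ℤ × d * a ≡ h * b + 1ℤ × d * (a + b) ≡ k * b + 1ℤ ×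
  Succeeds M a (a + b) h k
successor≤½ {M} {h} {d} {_} {a} {b} refl fh@(0≤h , _ , _ , _ , gcd≡1 , k-M≤h , h≤M)
  h≤d not-1/2 h∣da-1 c-h≤a a≤c-1 d∣hb+1 M-d<b b≤M =
  h[a+b]≡ka-1 , da≡hb+1 , proj₂ (proj₂ identities) ,
  unimodular⇒Precedes {M} {h} {d} {h + d} {a} {b} refl refl fh (InFB-+ 0≤a 0<b a≤M b≤M coprime)
    (trans (ℤP.*-comm a (h + d)) ka≡h[a+b]+1) (<-via-difference M-d<b (solve (M ∷ d ∷ b ∷ [])))
  where
  open ℤP.≤-Reasoning
  0<h : 0ℤ < h
  0<h = nonempty-window⇒0<h {ceilDiv (h * M + + 2) d} c-h≤a a≤c-1
  0<d : 0ℤ < d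
  0<d = ℤP.<-≤-trans 0<h h≤d
  0≤M : 0ℤ ≤ M
  0≤M = ℤP.≤-trans 0≤h h≤M
  0≤M-d : 0ℤ ≤ M - d
  0≤M-d = 0≤-via-difference k-M≤h (solve (M ∷ h ∷ d ∷ []))
  0<b : 0ℤ < b
  0<b = ℤP.≤-<-trans 0≤M-d M-d<b
  hM+2-1≡hM+1 : h * M + + 2 + -1ℤ ≡ h * M + 1ℤ
  hM+2-1≡hM+1 = solve (h ∷ M ∷ [])
  identities : h * (a + b) ≡ (h + d) * a - 1ℤ × d * a ≡ h * b + 1ℤ × d * (a + b) ≡ (h + d) * b + 1ℤ
  identities = mediant-identities {h} {d} {a} {b} { -1ℤ}
    (mediant-numerator≡ {x = h * M + + 2} (coprime-summands {h} refl (gcd≡1⇒coprime {h} {h + d} gcd≡1))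
      0<h 0<d (ℤP.≤-trans (0≤i*j 0≤h 0≤M) (ℤP.i≤i+j (h * M) (+ 2))) hM+2-1≡hM+1
      c-h≤a a≤c-1 h∣da-1 d∣hb+1 M-d<b b≤M)
  h[a+b]≡ka-1 : h * (a + b) ≡ (h + d) * a - 1ℤ
  h[a+b]≡ka-1 = proj₁ identities
  da≡hb+1 : d * a ≡ h * b + 1ℤ
  da≡hb+1 = proj₁ (proj₂ identities)
  ka≡h[a+b]+1 : (h + d) * a ≡ h * (a + b) + 1ℤ
  ka≡h[a+b]+1 = i≡j+k⇒j≡i-k h[a+b]≡ka-1
  0≤a : 0ℤ ≤ a
  0≤a = 0<i∧0≤i*j⇒0≤j 0<d
    (subst (0ℤ ≤_) (sym da≡hb+1) (ℤP.≤-trans (ℤP.<⇒≤ (0<i*j 0<h 0<b)) (ℤP.i≤i+j (h * b) 1ℤ)))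
  h<d : h < d
  h<d = ℤP.≤∧≢⇒< h≤d λ h≡d → not-1/2 (h≡1 h≡d , cong₂ _+_ (h≡1 h≡d) (trans (sym h≡d) (h≡1 h≡d)))
    where
    h≡1 : h ≡ d → h ≡ 1ℤ
    h≡1 refl = 0≤h∧h∣h*a-1⇒h≡1 0≤h h∣da-1
  a≤M : a ≤ M
  a≤M = ℤP.*-cancelˡ-≤-pos a M d ⦃ positive 0<d ⦄ (begin
    d * a              ≡⟨ da≡hb+1 ⟩
    h * b + 1ℤ         ≤⟨ ℤP.+-monoˡ-≤ 1ℤ (ℤP.*-monoˡ-≤-nonNeg h ⦃ nonNegative 0≤h ⦄ b≤M) ⟩
    h * M + 1ℤ         ≤⟨ ℤP.+-monoʳ-≤ (h * M) (ℤP.≤-trans (ℤP.i<j⇒suc[i]≤j 0<h) h≤M) ⟩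
    h * M + M          ≡⟨ solve (h ∷ M ∷ []) ⟩
    (1ℤ + h) * M       ≤⟨ ℤP.*-monoʳ-≤-nonNeg M ⦃ nonNegative 0≤M ⦄ (ℤP.i<j⇒suc[i]≤j h<d) ⟩
    d * M              ∎)
  coprime : Coprime a (a + b)
  coprime = bezout⇒coprime {h + d} {h} ka≡h[a+b]+1

-- Above one half, by passing to the complement (k - h)/k, with the roles of a and b exchanged

predecessor≥½ : ∀ {M h k} → InFB M h k → k ≤ + 2 * h → ¬ (h ≡ 1ℤ × k ≡ + 2) → ∀ a b →
  h ∣ k * a + 1ℤ → M - h + 1ℤ ≤ a → a ≤ M → (k - h) ∣ h * b - 1ℤ →
  ceilDiv ((k - h) * M + + 2) h - k + h ≤ b → b ≤ ceilDiv ((k - h) * M + + 2) h - 1ℤ →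
  Σ ℤ λ q → h * q ≡ k * a + 1ℤ × (k - h) * a ≡ h * b - 1ℤ × (k - h) * q ≡ k * b - 1ℤ ×
    Precedes M a q h k
predecessor≥½ {M} {h} {k} fh k≤2h not-1/2 a b h∣ka+1 M-h+1≤a a≤M k-h∣hb-1 c-k+h≤b b≤c-1 =
  b + a , proj₁ (proj₂ (proj₂ mirrored)) , i≡j+k⇒j≡i-k (proj₁ (proj₂ mirrored)) , proj₁ mirrored ,
  Precedes-complement {p = k - h} {h} {k} {b} {a} {b + a} (i-j+j≡i k h) refl (proj₂ (proj₂ (proj₂ mirrored)))
  where
  c : ℤ
  c = ceilDiv ((k - h) * M + + 2) h
  mirrored-not-1/2 : ¬ (k - h ≡ 1ℤ × k ≡ + 2)
  mirrored-not-1/2 (k-h≡1 , k≡2) = not-1/2 (h≡1 , k≡2)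
    where
    open ≡-Reasoning
    h≡1 : h ≡ 1ℤ
    h≡1 = begin
      h             ≡⟨ solve (h ∷ k ∷ []) ⟩
      k - (k - h)   ≡⟨ cong₂ _-_ k≡2 k-h≡1 ⟩
      + 2 - 1ℤ      ∎
  mirrored : (k - h) * (b + a) ≡ k * b - 1ℤ × h * b ≡ (k - h) * a + 1ℤ × h * (b + a) ≡ k * a + 1ℤ ×
             Succeeds M b (b + a) (k - h) k
  mirrored = successor≤½ {M} {k - h} {h} {k} {b} {a} (i-j+j≡i k h) (InFB-complement (i+[j-i]≡j h k) fh)
    (≤-via-difference k≤2h (solve (h ∷ k ∷ []))) mirrored-not-1/2
    k-h∣hb-1 (subst (_≤ b) (i-j+k≡i-[j-k] c k h) c-k+h≤b) b≤c-1
    (h∣k*a+ε⇒h∣[k-h]*a+ε {h} {k} {a} {1ℤ} h∣ka+1) (i+1≤j⇒i<j M-h+1≤a) a≤M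

successor≥½ : ∀ {M h k} → InFB M h k → k ≤ + 2 * h → ∀ a b →
  h ∣ k * a - 1ℤ → M - h + 1ℤ ≤ a → a ≤ M → (k - h) ∣ h * b + 1ℤ →
  ceilDiv ((k - h) * M) h - k + h ≤ b → b ≤ ceilDiv ((k - h) * M) h - 1ℤ →
  Σ ℤ λ q → h * q ≡ k * a - 1ℤ × (k - h) * a ≡ h * b + 1ℤ × (k - h) * q ≡ k * b + 1ℤ ×
    Succeeds M a q h k
successor≥½ {M} {h} {k} fh k≤2h a b h∣ka-1 M-h+1≤a a≤M k-h∣hb+1 c-k+h≤b b≤c-1 =
  b + a , proj₁ (proj₂ (proj₂ mirrored)) , i≡j+k⇒j≡i-k (proj₁ (proj₂ mirrored)) , proj₁ mirrored ,
  Precedes-complement {p = b} {a} {b + a} {k - h} {h} {k} refl (i-j+j≡i k h) (proj₂ (proj₂ (proj₂ mirrored)))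
  where
  c : ℤ
  c = ceilDiv ((k - h) * M) h
  mirrored : (k - h) * (b + a) ≡ k * b + 1ℤ × h * b ≡ (k - h) * a - 1ℤ × h * (b + a) ≡ k * a - 1ℤ ×
             Precedes M b (b + a) (k - h) k
  mirrored = predecessor≤½ {M} {k - h} {h} {k} {b} {a} (i-j+j≡i k h) (InFB-complement (i+[j-i]≡j h k) fh)
    (≤-via-difference k≤2h (solve (h ∷ k ∷ [])))
    k-h∣hb+1 (subst (_≤ b) (i-j+k≡i-[j-k] c k h) c-k+h≤b) b≤c-1
    (h∣k*a+ε⇒h∣[k-h]*a+ε {h} {k} {a} { -1ℤ} h∣ka-1) (i+1≤j⇒i<j M-h+1≤a) a≤M

proposition4p1 : (m : ℕ) → 1 ℕ.< m → (h k : ℤ) → InFB (+ m) h k →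
    -- (i) h/k ≤ 1/2
    (+ 2 * h ≤ k →
      -- (a) h/k ≠ 0/1 : predecessor
      (¬ (h ≡ 0ℤ × k ≡ 1ℤ) → (a b : ℤ) →
        h ∣ ((k - h) * a + 1ℤ) →
        ceilDiv (h * + m) (k - h) - h ≤ a → a ≤ ceilDiv (h * + m) (k - h) - 1ℤ →
        (k - h) ∣ (h * b - 1ℤ) →
        + m - k + h + 1ℤ ≤ b → b ≤ + m →
        Σ ℤ (λ q → h * q ≡ k * a + 1ℤ × (k - h) * a ≡ h * b - 1ℤ ×
          (k - h) * q ≡ k * b - 1ℤ × Precedes (+ m) a q h k))
      ×
      -- (b) h/k ≠ 1/2 : successor
      (¬ (h ≡ 1ℤ × k ≡ + 2) → (a b : ℤ) →
        h ∣ ((k - h) * a - 1ℤ) →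
        ceilDiv (h * + m + + 2) (k - h) - h ≤ a →
        a ≤ ceilDiv (h * + m + + 2) (k - h) - 1ℤ →
        (k - h) ∣ (h * b + 1ℤ) →
        + m - k + h + 1ℤ ≤ b → b ≤ + m →
        Σ ℤ (λ q → h * q ≡ k * a - 1ℤ × (k - h) * a ≡ h * b + 1ℤ ×
          (k - h) * q ≡ k * b + 1ℤ × Succeeds (+ m) a q h k)))
    ×
    -- (ii) h/k ≥ 1/2
    (k ≤ + 2 * h →
      -- (a) h/k ≠ 1/2 : predecessor
      (¬ (h ≡ 1ℤ × k ≡ + 2) → (a b : ℤ) →
        h ∣ (k * a + 1ℤ) →
        + m - h + 1ℤ ≤ a → a ≤ + m →
        (k - h) ∣ (h * b - 1ℤ) →
        ceilDiv ((k - h) * + m + + 2) h - k + h ≤ b →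
        b ≤ ceilDiv ((k - h) * + m + + 2) h - 1ℤ →
        Σ ℤ (λ q → h * q ≡ k * a + 1ℤ × (k - h) * a ≡ h * b - 1ℤ ×
          (k - h) * q ≡ k * b - 1ℤ × Precedes (+ m) a q h k))
      ×
      -- (b) h/k ≠ 1/1 : successor
      (¬ (h ≡ 1ℤ × k ≡ 1ℤ) → (a b : ℤ) →
        h ∣ (k * a - 1ℤ) →
        + m - h + 1ℤ ≤ a → a ≤ + m →
        (k - h) ∣ (h * b + 1ℤ) →
        ceilDiv ((k - h) * + m) h - k + h ≤ b →
        b ≤ ceilDiv ((k - h) * + m) h - 1ℤ →
        Σ ℤ (λ q → h * q ≡ k * a - 1ℤ × (k - h) * a ≡ h * b + 1ℤ ×
          (k - h) * q ≡ k * b + 1ℤ × Succeeds (+ m) a q h k)))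
-- The hypothesis 1 < m and the exclusions of 0/1 and 1/1 are deliberately unused: bounding a
-- in (i)(b) only needs m ≥ h ≥ 1, and for 0/1 resp. 1/1 the window for a resp. b is empty.
proposition4p1 m _ h k fh =
  (λ 2h≤k →
    (λ _ a b h∣ lo hi k-h∣ b-lo b≤M →
      a + b , predecessor≤½ (i+[j-i]≡j h k) fh (h≤k-h 2h≤k) h∣ lo hi k-h∣ (M-[k-h]<b b-lo) b≤M) ,
    (λ not-1/2 a b h∣ lo hi k-h∣ b-lo b≤M →
      a + b , successor≤½ (i+[j-i]≡j h k) fh (h≤k-h 2h≤k) not-1/2 h∣ lo hi k-h∣ (M-[k-h]<b b-lo) b≤M)) ,
  (λ k≤2h → predecessor≥½ fh k≤2h , λ _ → successor≥½ fh k≤2h)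
  where
  h≤k-h : + 2 * h ≤ k → h ≤ k - h
  h≤k-h 2h≤k = ≤-via-difference 2h≤k (solve (h ∷ k ∷ []))
  M-[k-h]<b : ∀ {b} → + m - k + h + 1ℤ ≤ b → + m - (k - h) < b
  M-[k-h]<b b-lo = i+1≤j⇒i<j (subst (_≤ _) (cong (_+ 1ℤ) (i-j+k≡i-[j-k] (+ m) k h)) b-lo)
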